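{- The logics ${\rm PLS}(Reg,K_1)$, ${\rm PLS}(Reg^*,K_2)$ and ${\rm PLS}(Dec,K_3)$ are sound, i.e. for $(X,K)$ any of the pairs $(Reg,K_1)$, $(Reg^*,K_2)$, $(Dec,K_3)$ and all $\Sigma\cup\{\varphi\}\subseteq Sen(L_s)$, $\Sigma\vdash_K\varphi$ implies $\Sigma\models_X\varphi$.
   Context: $L$: propositional language with atoms $p_0,p_1,\ldots$ and connectives $\neg,\wedge$ (others defined); $L_s$ adds a primitive binary connective $|$; $\sim$ is classical equivalence on $Sen(L)$, $[\alpha]=\{\beta:\beta\sim\alpha\}$. A choice function for $L$ is $f$ with $f(\alpha,\beta)=f(\{\alpha,\beta\})\in\{\alpha,\beta\}$. $Reg$: choice functions with $\alpha\sim\alpha'\Rightarrow f(\alpha,\beta)\sim f(\alpha',\beta)$. $Reg^*$: $f\in Reg$ of the form $\min_<$ for a total ordering $<$ of $Sen(L)$ (equivalently, $<$ regular: $\alpha\not\sim\beta,\alpha<\beta\Rightarrow\alpha'<\beta'$ for $\alpha'\in[\alpha],\beta'\in[\beta]$). $Dec$: $f=\min_<\in Reg^*$ with $<$ $\neg$-decreasing ($\alpha\not\sim\beta\Rightarrow(\alpha<\beta\iff\neg\beta<\neg\alpha)$). $f$ induces $\overline f:Sen(L_s)\to Sen(L)$: identity on $Sen(L)$, commuting with $\neg,\wedge$, $\overline f(\varphi|\psi)=f(\overline f(\varphi),\overline f(\psi))$; $\langle M,f\rangle\models_s\varphi$ iff $M\models\overline f(\varphi)$ for a classical truth assignment $M$;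 $\Sigma\models_X\varphi$ iff every $\langle M,f\rangle$ with $f\in X$ satisfying $\Sigma$ satisfies $\varphi$. Axiom schemes (instances over $Sen(L_s)$): PL: $\varphi\rightarrow(\psi\rightarrow\varphi)$, $(\varphi\rightarrow(\psi\rightarrow\sigma))\rightarrow((\varphi\rightarrow\psi)\rightarrow(\varphi\rightarrow\sigma))$, $(\neg\varphi\rightarrow\neg\psi)\rightarrow((\neg\varphi\rightarrow\psi)\rightarrow\varphi)$; $S_1$: $\varphi\wedge\psi\rightarrow\varphi|\psi$; $S_2$: $\varphi|\psi\rightarrow\varphi\vee\psi$; $S_3$: $\varphi|\psi\rightarrow\psi|\varphi$; $S_4$: $(\varphi|\psi)|\sigma\rightarrow\varphi|(\psi|\sigma)$; $S_5$: $\varphi\wedge\neg\psi\rightarrow(\varphi|\psi\leftrightarrow\neg\varphi|\neg\psi)$. $K_0$: axioms PL$+S_1+S_2+S_3$, rule Modus Ponens. $K_1$: same axioms as $K_0$, rules Modus Ponens and $SV$; $K_2$: $K_1$ plus $S_4$; $K_3$: $K_2$ plus $S_5$. Rule $SV$: from $\varphi\leftrightarrow\psi$ infer $\varphi|\sigma\leftrightarrow\psi|\sigma$, provided $\varphi\leftrightarrow\psi$ is provable in $K_0$. $\Sigma\vdash_K\varphi$: there is a finite sequence ending in $\varphi$ whose members are in $\Sigma$, axioms of $K$, or obtained by rules of $K$ from earlier members. -}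

module Defs where

open import Data.Nat using (ℕ)
open import Data.Empty using (⊥)
open import Level using (Level)
open import Data.Bool using (Bool; true; false; not; _∧_)
open import Data.Product using (Σ; _×_; ∃; _,_)
open import Data.Sum using (_⊎_)
open import Relation.Binary.PropositionalEquality using (_≡_; _≢_)
open import Relation.Nullary using (¬_)

data SenL : Set where
  atom : ℕ → SenL
  neg  : SenL → SenL
  conj : SenL → SenL → SenL

Assignment : Set
Assignment = ℕ → Bool

eval : Assignment → SenL → Bool
eval M (atom n)   = M n
eval M (neg α)    = not (eval M α)
eval M (conj α β) = eval M α ∧ eval M β

_⊨_ : Assignment → SenL → Set
M ⊨ α = eval M α ≡ true

_∼_ : SenL → SenL → Set
α ∼ β = ∀ (M : Assignment) → eval M α ≡ eval M β

data SenS : Set where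
  atom : ℕ → SenS
  neg  : SenS → SenS
  conj : SenS → SenS → SenS
  sel  : SenS → SenS → SenS

_⇒_ : SenS → SenS → SenS
φ ⇒ ψ = neg (conj φ (neg ψ))

_∨ₛ_ : SenS → SenS → SenS
φ ∨ₛ ψ = neg (conj (neg φ) (neg ψ))

_⇔_ : SenS → SenS → SenS
φ ⇔ ψ = conj (φ ⇒ ψ) (ψ ⇒ φ)

infixr 4 _⇒_ _⇔_
infixr 5 _∨ₛ_

-- Choice functions for L.  f(α,β) = f({α,β}), so f is symmetric, and
-- f(α,β) ∈ {α,β}.

record ChoiceFn : Set where
  field
    fn     : SenL → SenL → SenL
    sym    : ∀ α β → fn α β ≡ fn β α
    choose : ∀ α β → (fn α β ≡ α) ⊎ (fn α β ≡ β)
open ChoiceFn public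

Reg : ChoiceFn → Set
Reg f = ∀ α α' β → α ∼ α' → fn f α β ∼ fn f α' β

record IsTotalOrder (_<_ : SenL → SenL → Set) : Set where
  field
    irrefl : ∀ α → ¬ (α < α)
    trans  : ∀ α β γ → α < β → β < γ → α < γ
    total  : ∀ α β → α ≢ β → (α < β) ⊎ (β < α)

IsMin : ChoiceFn → (SenL → SenL → Set) → Set
IsMin f _<_ = ∀ α β → α < β → fn f α β ≡ α

RegStar : ChoiceFn → Set₁
RegStar f = Reg f × ∃ λ (_<_ : SenL → SenL → Set) → IsTotalOrder _<_ × IsMin f _<_

NegDecreasing : (SenL → SenL → Set) → Set
NegDecreasing _<_ = ∀ α β → ¬ (α ∼ β) → ((α < β → neg β < neg α) × (neg β < neg α → α < β))

DecF : ChoiceFn → Set₁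
DecF f = Reg f × ∃ λ (_<_ : SenL → SenL → Set) →
           IsTotalOrder _<_ × IsMin f _<_ × NegDecreasing _<_

fbar : ChoiceFn → SenS → SenL
fbar f (atom n)   = atom n
fbar f (neg φ)    = neg (fbar f φ)
fbar f (conj φ ψ) = conj (fbar f φ) (fbar f ψ)
fbar f (sel φ ψ)  = fn f (fbar f φ) (fbar f ψ)

_,_⊨ₛ_ : Assignment → ChoiceFn → SenS → Set
M , f ⊨ₛ φ = M ⊨ fbar f φ

_⊨[_]_ : ∀ {ℓ} → (SenS → Set) → (ChoiceFn → Set ℓ) → SenS → Set ℓ
Γ ⊨[ X ] φ = ∀ (M : Assignment) (f : ChoiceFn) → X f →
             (∀ ψ → Γ ψ → M , f ⊨ₛ ψ) → M , f ⊨ₛ φ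

data System : Set where
  K0 K1 K2 K3 : System

data HasS4 : System → Set where
  k2 : HasS4 K2
  k3 : HasS4 K3

data HasS5 : System → Set where
  k3 : HasS5 K3

data HasSV : System → Set where
  k1 : HasSV K1
  k2 : HasSV K2
  k3 : HasSV K3

data Axiom : System → SenS → Set where
  pl1 : ∀ {K} φ ψ → Axiom K (φ ⇒ (ψ ⇒ φ))
  pl2 : ∀ {K} φ ψ σ → Axiom K ((φ ⇒ (ψ ⇒ σ)) ⇒ ((φ ⇒ ψ) ⇒ (φ ⇒ σ)))
  pl3 : ∀ {K} φ ψ → Axiom K ((neg φ ⇒ neg ψ) ⇒ ((neg φ ⇒ ψ) ⇒ φ))
  s1  : ∀ {K} φ ψ → Axiom K (conj φ ψ ⇒ sel φ ψ)
  s2  : ∀ {K} φ ψ → Axiom K (sel φ ψ ⇒ (φ ∨ₛ ψ))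
  s3  : ∀ {K} φ ψ → Axiom K (sel φ ψ ⇒ sel ψ φ)
  s4  : ∀ {K} → HasS4 K → ∀ φ ψ σ → Axiom K (sel (sel φ ψ) σ ⇒ sel φ (sel ψ σ))
  s5  : ∀ {K} → HasS5 K → ∀ φ ψ →
        Axiom K (conj φ (neg ψ) ⇒ (sel φ ψ ⇔ sel (neg φ) (neg ψ)))

∅ : SenS → Set
∅ _ = ⊥

-- Σ ⊢_K φ (derivations, i.e. finite proof sequences, as trees).
-- Rule SV: from φ ↔ ψ (an earlier line) infer φ|σ ↔ ψ|σ, provided
-- φ ↔ ψ is provable in K₀ (from no premises).
data _⊢[_]_ (Γ : SenS → Set) (K : System) : SenS → Set where
  hyp : ∀ {φ} → Γ φ → Γ ⊢[ K ] φ
  ax  : ∀ {φ} → Axiom K φ → Γ ⊢[ K ] φ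
  mp  : ∀ {φ ψ} → Γ ⊢[ K ] φ → Γ ⊢[ K ] (φ ⇒ ψ) → Γ ⊢[ K ] ψ
  sv  : ∀ {φ ψ} σ → HasSV K → ∅ ⊢[ K0 ] (φ ⇔ ψ) → Γ ⊢[ K ] (φ ⇔ ψ) →
        Γ ⊢[ K ] (sel φ σ ⇔ sel ψ σ)

-- PL and S₁–S₃ hold under every choice function, since
-- f(α,β) is one of α, β and f is symmetric. SV is valid for regular f: a K₀-provable
-- equivalence is valid under every f, so both sides of it have classically equivalent
-- translations. S₄ holds for f = min_< because the minimum of a total order is associative.
-- S₅ holds when < is moreover ¬-decreasing: for inequivalent α, β, f picks α from {α, β}
-- exactly when it picks ¬β from {¬α, ¬β}, so if α is true and β false then f(α,β) and
-- f(¬α,¬β) are both true or both false.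
module Submission where

open import Defs
open import Relation.Binary.PropositionalEquality
  using (_≡_; _≢_; refl; trans; cong; cong₂; isEquivalence; resp₂; module ≡-Reasoning)
  renaming (sym to ≡-sym)
open import Algebra.Definitions (_≡_ {A = SenL}) using (Associative)
import Algebra.Construct.NaturalChoice.MinOp as MinOp
open import Algebra.Construct.NaturalChoice.Base using (MinOperator)
open import Data.Bool using (Bool; true; false; not; _∧_)
open import Data.Bool.Properties using (∧-conicalˡ; ∧-conicalʳ; not-injective)
import Data.Nat as ℕ
open import Data.Unit using (⊤; tt)
open import Data.Product using (_×_; _,_; proj₁)
open import Data.Sum using (_⊎_; inj₁; inj₂; [_,_]′)
import Data.Sum as Sum
open import Relation.Binary.Bundles using (TotalOrder)
import Relation.Binary.Construct.StrictToNonStrict as StrictToNonStrict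
open import Relation.Binary.Definitions using (DecidableEquality; Trichotomous; tri<; tri≈; tri>)
import Relation.Binary.Structures as B
open import Relation.Nullary using (¬_; yes; no; contradiction)
open import Relation.Nullary.Decidable using (map′; _×-dec_)

_≟_ : DecidableEquality SenL
atom m ≟ atom n = map′ (cong atom) (λ { refl → refl }) (m ℕ.≟ n)
neg α ≟ neg β = map′ (cong neg) (λ { refl → refl }) (α ≟ β)
conj α β ≟ conj γ δ =
  map′ (λ (p , q) → cong₂ conj p q) (λ { refl → refl , refl }) (α ≟ γ ×-dec β ≟ δ)
atom _ ≟ neg _ = no λ ()
atom _ ≟ conj _ _ = no λ ()
neg _ ≟ atom _ = no λ ()
neg _ ≟ conj _ _ = no λ ()
conj _ _ ≟ atom _ = no λ ()
conj _ _ ≟ neg _ = no λ ()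

-- The property of f that makes S₅ valid.
SwapsUnderNegation : ChoiceFn → Set
SwapsUnderNegation f =
  ∀ α β → ¬ (α ∼ β) → fn f α β ≡ α → fn f (neg α) (neg β) ≡ neg β

module _ {_<_ : SenL → SenL → Set} (<-isTotalOrder : IsTotalOrder _<_) where
  open IsTotalOrder <-isTotalOrder renaming (irrefl to <-irrefl; trans to <-trans; total to <-total)

  <-trichotomous : Trichotomous _≡_ _<_
  <-trichotomous α β with α ≟ β
  ... | yes refl = tri≈ (<-irrefl α) refl (<-irrefl α)
  ... | no α≢β with <-total α β α≢β
  ...   | inj₁ α<β = tri< α<β α≢β (λ β<α → <-irrefl α (<-trans α β α α<β β<α))
  ...   | inj₂ β<α = tri> (λ α<β → <-irrefl α (<-trans α β α α<β β<α)) α≢β β<α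

  <-isStrictTotalOrder : B.IsStrictTotalOrder _≡_ _<_
  <-isStrictTotalOrder = record
    { isStrictPartialOrder = record
      { isEquivalence = isEquivalence
      ; irrefl        = λ { refl → <-irrefl _ }
      ; trans         = <-trans _ _ _
      ; <-resp-≈      = resp₂ _<_
      }
    ; compare = <-trichotomous
    }

  ≤-totalOrder : TotalOrder _ _ _
  ≤-totalOrder = record
    { isTotalOrder = StrictToNonStrict.isTotalOrder _≡_ _<_ <-isStrictTotalOrder }

  min-assoc : ∀ f → IsMin f _<_ → Associative (fn f)
  min-assoc f f-min = MinOp.⊓-assoc minOperator
    where
    idem : ∀ α → fn f α α ≡ α
    idem α with choose f α α
    ... | inj₁ e = e
    ... | inj₂ e = e

    ≤⇒min : ∀ {α β} → (α < β) ⊎ (α ≡ β) → fn f α β ≡ α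
    ≤⇒min (inj₁ α<β) = f-min _ _ α<β
    ≤⇒min (inj₂ refl) = idem _

    minOperator : MinOperator (TotalOrder.totalPreorder ≤-totalOrder)
    minOperator = record
      { _⊓_ = fn f
      ; x≤y⇒x⊓y≈x = ≤⇒min
      ; x≥y⇒x⊓y≈y = λ β≤α → trans (sym f _ _) (≤⇒min β≤α)
      }

  min-swapsUnderNegation : ∀ f → IsMin f _<_ → NegDecreasing _<_ → SwapsUnderNegation f
  min-swapsUnderNegation f f-min neg-dec α β α≁β fαβ≡α =
    [ (λ α<β → trans (sym f _ _) (f-min _ _ (proj₁ (neg-dec α β α≁β) α<β)))
    , (λ β<α → contradiction (trans (≡-sym fαβ≡α) (trans (sym f α β) (f-min β α β<α))) α≢β)
    ]′ (<-total α β α≢β)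
    where
    α≢β : α ≢ β
    α≢β refl = α≁β λ _ → refl

-- Truth functions of the connectives defined in Defs, so that for instance
-- eval M (fbar f (φ ⇒ ψ)) computes to eval M (fbar f φ) →ᵇ eval M (fbar f ψ).
infixr 5 _→ᵇ_ _↔ᵇ_
infixr 6 _∨ᵇ_

_→ᵇ_ _↔ᵇ_ _∨ᵇ_ : Bool → Bool → Bool
x →ᵇ y = not (x ∧ not y)
x ↔ᵇ y = (x →ᵇ y) ∧ (y →ᵇ x)
x ∨ᵇ y = not (not x ∧ not y)

→ᵇ-intro : ∀ {x y} → (x ≡ true → y ≡ true) → x →ᵇ y ≡ true
→ᵇ-intro {false} _ = refl
→ᵇ-intro {true} y-true rewrite y-true refl = refl

→ᵇ-elim : ∀ {x y} → x ≡ true → x →ᵇ y ≡ true → y ≡ true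
→ᵇ-elim {y = true} _ _ = refl
→ᵇ-elim {true} {false} _ ()

↔ᵇ-intro : ∀ {x y} → x ≡ y → x ↔ᵇ y ≡ true
↔ᵇ-intro {false} refl = refl
↔ᵇ-intro {true} refl = refl

↔ᵇ-elim : ∀ {x y} → x ↔ᵇ y ≡ true → x ≡ y
↔ᵇ-elim {false} {false} _ = refl
↔ᵇ-elim {true} {true} _ = refl
↔ᵇ-elim {false} {true} ()
↔ᵇ-elim {true} {false} ()

∨ᵇ-introˡ : ∀ {x} y → x ≡ true → x ∨ᵇ y ≡ true
∨ᵇ-introˡ _ refl = refl

∨ᵇ-introʳ : ∀ x {y} → y ≡ true → x ∨ᵇ y ≡ true
∨ᵇ-introʳ false refl = refl
∨ᵇ-introʳ true refl = refl

K-tautology : ∀ x y → x →ᵇ (y →ᵇ x) ≡ true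
K-tautology false _ = refl
K-tautology true false = refl
K-tautology true true = refl

S-tautology : ∀ x y z → (x →ᵇ (y →ᵇ z)) →ᵇ ((x →ᵇ y) →ᵇ (x →ᵇ z)) ≡ true
S-tautology false _ _ = refl
S-tautology true false _ = refl
S-tautology true true false = refl
S-tautology true true true = refl

contraposition-tautology : ∀ x y → (not x →ᵇ not y) →ᵇ ((not x →ᵇ y) →ᵇ x) ≡ true
contraposition-tautology true _ = refl
contraposition-tautology false false = refl
contraposition-tautology false true = refl

module _ (M : Assignment) (f : ChoiceFn) where
  open ≡-Reasoning

  ⟦_⟧ : SenS → Bool
  ⟦ φ ⟧ = eval M (fbar f φ)

  sel-value : ∀ φ ψ → (⟦ sel φ ψ ⟧ ≡ ⟦ φ ⟧) ⊎ (⟦ sel φ ψ ⟧ ≡ ⟦ ψ ⟧)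
  sel-value φ ψ = Sum.map (cong (eval M)) (cong (eval M)) (choose f (fbar f φ) (fbar f ψ))

  S₁-valid : ∀ φ ψ → M , f ⊨ₛ (conj φ ψ ⇒ sel φ ψ)
  S₁-valid φ ψ = →ᵇ-intro λ φ∧ψ →
    [ (λ e → trans e (∧-conicalˡ _ _ φ∧ψ)) , (λ e → trans e (∧-conicalʳ _ _ φ∧ψ)) ]′ (sel-value φ ψ)

  S₂-valid : ∀ φ ψ → M , f ⊨ₛ (sel φ ψ ⇒ (φ ∨ₛ ψ))
  S₂-valid φ ψ = →ᵇ-intro λ φ|ψ →
    [ (λ e → ∨ᵇ-introˡ ⟦ ψ ⟧ (trans (≡-sym e) φ|ψ)) , (λ e → ∨ᵇ-introʳ ⟦ φ ⟧ (trans (≡-sym e) φ|ψ)) ]′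
      (sel-value φ ψ)

  S₃-valid : ∀ φ ψ → M , f ⊨ₛ (sel φ ψ ⇒ sel ψ φ)
  S₃-valid φ ψ = →ᵇ-intro (trans (cong (eval M) (sym f (fbar f ψ) (fbar f φ))))

  S₄-valid : Associative (fn f) → ∀ φ ψ σ → M , f ⊨ₛ (sel (sel φ ψ) σ ⇒ sel φ (sel ψ σ))
  S₄-valid assoc φ ψ σ = →ᵇ-intro (trans (cong (eval M) (≡-sym (assoc (fbar f φ) (fbar f ψ) (fbar f σ)))))

  S₅-valid : SwapsUnderNegation f → ∀ φ ψ → M , f ⊨ₛ (conj φ (neg ψ) ⇒ (sel φ ψ ⇔ sel (neg φ) (neg ψ)))
  S₅-valid swaps φ ψ = →ᵇ-intro λ φ∧¬ψ →
    ↔ᵇ-intro (neg-sel-value (∧-conicalˡ _ _ φ∧¬ψ) (not-injective (∧-conicalʳ _ _ φ∧¬ψ)))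
    where
    α = fbar f φ
    β = fbar f ψ

    α≁β : eval M α ≡ true → eval M β ≡ false → ¬ (α ∼ β)
    α≁β α-true β-false α∼β with trans (≡-sym α-true) (trans (α∼β M) β-false)
    ... | ()

    neg-sel-value : eval M α ≡ true → eval M β ≡ false → eval M (fn f α β) ≡ eval M (fn f (neg α) (neg β))
    neg-sel-value α-true β-false with choose f α β
    ... | inj₁ fαβ≡α = begin
      eval M (fn f α β)             ≡⟨ cong (eval M) fαβ≡α ⟩
      eval M α                      ≡⟨ α-true ⟩
      true                          ≡⟨ cong not β-false ⟨
      eval M (neg β)                ≡⟨ cong (eval M) (swaps α β (α≁β α-true β-false) fαβ≡α) ⟨
      eval M (fn f (neg α) (neg β)) ∎
    ... | inj₂ fαβ≡β = begin
      eval M (fn f α β)             ≡⟨ cong (eval M) fαβ≡β ⟩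
      eval M β                      ≡⟨ β-false ⟩
      false                         ≡⟨ cong not α-true ⟨
      eval M (neg α)                ≡⟨ cong (eval M) f¬α¬β≡¬α ⟨
      eval M (fn f (neg α) (neg β)) ∎
      where
      β≁α : ¬ (β ∼ α)
      β≁α β∼α = α≁β α-true β-false λ N → ≡-sym (β∼α N)

      f¬α¬β≡¬α : fn f (neg α) (neg β) ≡ neg α
      f¬α¬β≡¬α = trans (sym f _ _) (swaps β α β≁α (trans (sym f β α) fαβ≡β))

  axiom-valid : ∀ {K φ} → (HasS4 K → Associative (fn f)) → (HasS5 K → SwapsUnderNegation f) →
                Axiom K φ → M , f ⊨ₛ φ
  axiom-valid _ _ (pl1 φ ψ) = K-tautology ⟦ φ ⟧ ⟦ ψ ⟧
  axiom-valid _ _ (pl2 φ ψ σ) = S-tautology ⟦ φ ⟧ ⟦ ψ ⟧ ⟦ σ ⟧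
  axiom-valid _ _ (pl3 φ ψ) = contraposition-tautology ⟦ φ ⟧ ⟦ ψ ⟧
  axiom-valid _ _ (s1 φ ψ) = S₁-valid φ ψ
  axiom-valid _ _ (s2 φ ψ) = S₂-valid φ ψ
  axiom-valid _ _ (s3 φ ψ) = S₃-valid φ ψ
  axiom-valid assoc _ (s4 k φ ψ σ) = S₄-valid (assoc k) φ ψ σ
  axiom-valid _ swaps (s5 k φ ψ) = S₅-valid (swaps k) φ ψ

sound : ∀ {ℓ K Γ φ} {X : ChoiceFn → Set ℓ} →
        (∀ {φ} → Axiom K φ → ∀ M f → X f → M , f ⊨ₛ φ) →
        (∀ {φ ψ} σ → HasSV K → ∅ ⊢[ K0 ] (φ ⇔ ψ) → ∀ M f → X f → M , f ⊨ₛ (sel φ σ ⇔ sel ψ σ)) →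
        Γ ⊢[ K ] φ → Γ ⊨[ X ] φ
sound _ _ (hyp Γφ) M f _ Γ-true = Γ-true _ Γφ
sound axioms _ (ax a) M f f∈X _ = axioms a M f f∈X
sound axioms rule (mp d e) M f f∈X Γ-true =
  →ᵇ-elim (sound axioms rule d M f f∈X Γ-true) (sound axioms rule e M f f∈X Γ-true)
sound _ rule (sv σ k d₀ _) M f f∈X _ = rule σ k d₀ M f f∈X

K0-sound : ∀ {φ} → ∅ ⊢[ K0 ] φ → ∀ M f → M , f ⊨ₛ φ
K0-sound d M f =
  sound {X = λ _ → ⊤} (λ a M f _ → axiom-valid M f (λ ()) (λ ()) a) (λ _ ()) d M f tt λ _ ()

SV-valid : ∀ {φ ψ} σ → ∅ ⊢[ K0 ] (φ ⇔ ψ) → ∀ M f → Reg f → M , f ⊨ₛ (sel φ σ ⇔ sel ψ σ)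
SV-valid {φ} {ψ} σ d₀ M f f-reg =
  ↔ᵇ-intro (f-reg (fbar f φ) (fbar f ψ) (fbar f σ) (λ N → ↔ᵇ-elim (K0-sound d₀ N f)) M)

theorem3p13 : (∀ (Γ : SenS → Set) (φ : SenS) → Γ ⊢[ K1 ] φ → Γ ⊨[ Reg ] φ)
    × (∀ (Γ : SenS → Set) (φ : SenS) → Γ ⊢[ K2 ] φ → Γ ⊨[ RegStar ] φ)
    × (∀ (Γ : SenS → Set) (φ : SenS) → Γ ⊢[ K3 ] φ → Γ ⊨[ DecF ] φ)
theorem3p13 =
    (λ _ _ → sound (λ a M f _ → axiom-valid M f (λ ()) (λ ()) a)
                   (λ σ _ → SV-valid σ))
  , (λ _ _ → sound (λ a M f (_ , _ , <-tot , f-min) →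
                      axiom-valid M f (λ _ → min-assoc <-tot f f-min) (λ ()) a)
                   (λ σ _ d₀ M f (f-reg , _) → SV-valid σ d₀ M f f-reg))
  , (λ _ _ → sound (λ a M f (_ , _ , <-tot , f-min , neg-dec) →
                      axiom-valid M f (λ _ → min-assoc <-tot f f-min)
                                      (λ _ → min-swapsUnderNegation <-tot f f-min neg-dec) a)
                   (λ σ _ d₀ M f (f-reg , _) → SV-valid σ d₀ M f f-reg))
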